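{- In the core logic for exceptions: (1) for all propagators $a_1,a_2:P\to Y$ and pure terms $u_1,u_2:X\to P$, with $f_i=a_i\circ\mathtt{untag}\circ\mathtt{tag}\circ u_i$ ($i=1,2$), the weak equation $f_1\sim f_2$ is $T_{excore}$-equivalent to $a_1\circ u_1\equiv a_2\circ u_2$, and the strong equation $f_1\equiv f_2$ is $T_{excore}$-equivalent to $\{a_1\equiv a_2,\ a_1\circ u_1\equiv a_2\circ u_2\}$; (2) for all propagators $a_1:P\to Y$, $a_2:X\to Y$ and pure $u_1:X\to P$, with $f_1=a_1\circ\mathtt{untag}\circ\mathtt{tag}\circ u_1$, the equation $f_1\sim a_2$ is $T_{excore}$-equivalent to $a_1\circ u_1\equiv a_2$, and $f_1\equiv a_2$ is $T_{excore}$-equivalent to $\{a_1\circ u_1\equiv a_2,\ a_1\equiv[\,]_Y\circ\mathtt{tag}\}$; (3) assume that $[\,]_Y$ is a monomorphism with respect to propagators; for all pure $v_1,v_2:X\to P$, with $a_i=[\,]_Y\circ\mathtt{tag}\circ v_i$, the equation $a_1\equiv a_2$ is $T_{excore}$-equivalent to $v_1\equiv v_2$.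
   Context: Monadic equational logic $L_{eqn}$ (with empty type): types and terms generated by a signature of unary operations, terms being composable paths (with identities); an empty type $\mathbb{0}$ with a term $[\,]_Y:\mathbb{0}\to Y$ for each $Y$. Rules: $\equiv$ is an equivalence relation; (subs) from $v_1\equiv v_2:Y\to Z$ and $u:X\to Y$ infer $v_1\circ u\equiv v_2\circ u$; (repl) from $v_1\equiv v_2:X\to Y$ and $w:Y\to Z$ infer $w\circ v_1\equiv w\circ v_2$; (initial) every $u:\mathbb{0}\to Y$ satisfies $u\equiv[\,]_Y$. Core logic for exceptions $L_{excore}$: pure part $L_{eqn}$ with a distinguished type $P$. Terms are composites of pure terms, $\mathtt{tag}:P\to\mathbb{0}$ (decoration $(1)$) and $\mathtt{untag}:\mathbb{0}\to P$ (decoration $(2)$); decoration of a composite is the maximum; pure = decoration $(0)$, propagator = decoration at most $(1)$, every term is a catcher. Formulas: strong equations $f\equiv g$ and weak equations $f\sim g$. Rules: for $\equiv$: equivalence, (subs), (repl) for all decorations; for $\sim$: equivalence and (repl) for all decorations, (subs) only with a pure substituted term; (empty$_\sim$) every $f:\mathbb{0}\to Y$ satisfies $f\sim[\,]_Y$; $f\equiv g$ implies $f\sim g$; (ax) $\mathtt{untag}\circ\mathtt{tag}\sim\mathrm{id}_P$; (eq$_1$) $f_1\sim f_2$ with $f_1,f_2$ propagators implies $f_1\equiv f_2$; (eq$_2$) for $f_1,f_2:X\to Y$, $f_1\sim f_2$ and $f_1\circ[\,]_X\equiv f_2\circ[\,]_X$ imply $f_1\equiv f_2$; (eq$_3$)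 for $f_1,f_2:\mathbb{0}\to X$, $f_1\circ\mathtt{tag}\sim f_2\circ\mathtt{tag}$ implies $f_1\equiv f_2$; plus the rules of $L_{eqn}$ for pure terms. $T_{excore}$ is the theory generated by a fixed theory $T_{eqn}$ of $L_{eqn}$. $\mathrm{Th}(E)$ is the theory generated by a set $E$ of formulas, $T+T'$ the theory generated by $T\cup T'$; sets $E_1,E_2$ of formulas are $T$-equivalent if $T+\mathrm{Th}(E_1)=T+\mathrm{Th}(E_2)$. $[\,]_Y$ is a monomorphism with respect to propagators if for all propagators $b_1,b_2:X\to\mathbb{0}$, $[\,]_Y\circ b_1\equiv[\,]_Y\circ b_2$ implies $b_1\equiv b_2$. -}

module Defs where

open import Data.Nat using (ℕ; zero; suc; _⊔_; _≤_)
open import Data.Sum using (_⊎_)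
open import Data.Product using (_×_)
open import Data.Empty using (⊥)
open import Relation.Binary.PropositionalEquality using (_≡_)

data Ty (B : Set) : Set where
  base : B → Ty B
  𝟘    : Ty B

record Sig : Set₁ where
  field
    Base : Set
    Op   : Ty Base → Ty Base → Set
    P    : Ty Base

module Excore (S : Sig) where
  open Sig S public

  Type : Set
  Type = Ty Base

  data PAtom : Type → Type → Set where
    op  : ∀ {X Y} → Op X Y → PAtom X Y
    emp : ∀ Y → PAtom 𝟘 Y

  data Atom : Type → Type → Set where
    pureA  : ∀ {X Y} → PAtom X Y → Atom X Y
    tagA   : Atom P 𝟘
    untagA : Atom 𝟘 P

  data Path (A : Type → Type → Set) (X : Type) : Type → Set where
    id  : Path A X X
    _·_ : ∀ {Y Z} → A Y Z → Path A X Y → Path A X Z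

  infixr 9 _∘_
  _∘_ : ∀ {A X Y Z} → Path A Y Z → Path A X Y → Path A X Z
  id      ∘ f = f
  (a · g) ∘ f = a · (g ∘ f)

  PTerm : Type → Type → Set
  PTerm = Path PAtom

  Term : Type → Type → Set
  Term = Path Atom

  []ₚ : ∀ Y → PTerm 𝟘 Y
  []ₚ Y = emp Y · id

  ι : ∀ {X Y} → PTerm X Y → Term X Y
  ι id      = id
  ι (a · f) = pureA a · ι f

  [_] : ∀ Y → Term 𝟘 Y
  [ Y ] = pureA (emp Y) · id

  tag : Term P 𝟘
  tag = tagA · id

  untag : Term 𝟘 P
  untag = untagA · id

  -- decorations: 0 = pure, 1 = propagator, 2 = catcher; composite = max
  decoA : ∀ {X Y} → Atom X Y → ℕ
  decoA (pureA _) = 0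
  decoA tagA      = 1
  decoA untagA    = 2

  deco : ∀ {X Y} → Term X Y → ℕ
  deco id      = 0
  deco (a · f) = decoA a ⊔ deco f

  IsPure : ∀ {X Y} → Term X Y → Set
  IsPure f = deco f ≡ 0

  IsPropagator : ∀ {X Y} → Term X Y → Set
  IsPropagator f = deco f ≤ 1

  infix 4 _≐_
  data PEq : Set where
    _≐_ : ∀ {X Y} → PTerm X Y → PTerm X Y → PEq

  data EqnDer (T : PEq → Set) : PEq → Set where
    hyp     : ∀ {e} → T e → EqnDer T e
    refl    : ∀ {X Y} (f : PTerm X Y) → EqnDer T (f ≐ f)
    sym     : ∀ {X Y} {f g : PTerm X Y} → EqnDer T (f ≐ g) → EqnDer T (g ≐ f)
    trans   : ∀ {X Y} {f g h : PTerm X Y} →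
              EqnDer T (f ≐ g) → EqnDer T (g ≐ h) → EqnDer T (f ≐ h)
    subs    : ∀ {X Y Z} {v₁ v₂ : PTerm Y Z} (u : PTerm X Y) →
              EqnDer T (v₁ ≐ v₂) → EqnDer T (v₁ ∘ u ≐ v₂ ∘ u)
    repl    : ∀ {X Y Z} {v₁ v₂ : PTerm X Y} (w : PTerm Y Z) →
              EqnDer T (v₁ ≐ v₂) → EqnDer T (w ∘ v₁ ≐ w ∘ v₂)
    initial : ∀ {Y} (u : PTerm 𝟘 Y) → EqnDer T (u ≐ []ₚ Y)

  IsEqnTheory : (PEq → Set) → Set
  IsEqnTheory T = ∀ e → EqnDer T e → T e

  infix 4 _≣_ _∼_
  data Formula : Set where
    _≣_ : ∀ {X Y} → Term X Y → Term X Y → Formula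
    _∼_ : ∀ {X Y} → Term X Y → Term X Y → Formula

  -- Der Teqn E φ : φ belongs to the theory generated by Teqn ∪ E,
  -- i.e. to T_excore + Th(E)
  data Der (Teqn : PEq → Set) (E : Formula → Set) : Formula → Set where
    eqn      : ∀ {X Y} {u v : PTerm X Y} → Teqn (u ≐ v) → Der Teqn E (ι u ≣ ι v)
    hyp      : ∀ {φ} → E φ → Der Teqn E φ
    s-refl   : ∀ {X Y} (f : Term X Y) → Der Teqn E (f ≣ f)
    s-sym    : ∀ {X Y} {f g : Term X Y} → Der Teqn E (f ≣ g) → Der Teqn E (g ≣ f)
    s-trans  : ∀ {X Y} {f g h : Term X Y} →
               Der Teqn E (f ≣ g) → Der Teqn E (g ≣ h) → Der Teqn E (f ≣ h)
    s-subs   : ∀ {X Y Z} {v₁ v₂ : Term Y Z} (u : Term X Y) →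
               Der Teqn E (v₁ ≣ v₂) → Der Teqn E (v₁ ∘ u ≣ v₂ ∘ u)
    s-repl   : ∀ {X Y Z} {v₁ v₂ : Term X Y} (w : Term Y Z) →
               Der Teqn E (v₁ ≣ v₂) → Der Teqn E (w ∘ v₁ ≣ w ∘ v₂)
    w-refl   : ∀ {X Y} (f : Term X Y) → Der Teqn E (f ∼ f)
    w-sym    : ∀ {X Y} {f g : Term X Y} → Der Teqn E (f ∼ g) → Der Teqn E (g ∼ f)
    w-trans  : ∀ {X Y} {f g h : Term X Y} →
               Der Teqn E (f ∼ g) → Der Teqn E (g ∼ h) → Der Teqn E (f ∼ h)
    w-subs   : ∀ {X Y Z} {v₁ v₂ : Term Y Z} (u : Term X Y) → IsPure u →
               Der Teqn E (v₁ ∼ v₂) → Der Teqn E (v₁ ∘ u ∼ v₂ ∘ u)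
    w-repl   : ∀ {X Y Z} {v₁ v₂ : Term X Y} (w : Term Y Z) →
               Der Teqn E (v₁ ∼ v₂) → Der Teqn E (w ∘ v₁ ∼ w ∘ v₂)
    empty∼   : ∀ {Y} (f : Term 𝟘 Y) → Der Teqn E (f ∼ [ Y ])
    s⇒w      : ∀ {X Y} {f g : Term X Y} → Der Teqn E (f ≣ g) → Der Teqn E (f ∼ g)
    ax       : Der Teqn E (untag ∘ tag ∼ id)
    eq₁      : ∀ {X Y} {f₁ f₂ : Term X Y} → IsPropagator f₁ → IsPropagator f₂ →
               Der Teqn E (f₁ ∼ f₂) → Der Teqn E (f₁ ≣ f₂)
    eq₂      : ∀ {X Y} {f₁ f₂ : Term X Y} → Der Teqn E (f₁ ∼ f₂) →
               Der Teqn E (f₁ ∘ [ X ] ≣ f₂ ∘ [ X ]) → Der Teqn E (f₁ ≣ f₂)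
    eq₃      : ∀ {X} {f₁ f₂ : Term 𝟘 X} →
               Der Teqn E (f₁ ∘ tag ∼ f₂ ∘ tag) → Der Teqn E (f₁ ≣ f₂)
    -- the rule (initial) of L_eqn for pure terms (other L_eqn rules are
    -- instances of the rules above)
    initial  : ∀ {Y} (u : Term 𝟘 Y) → IsPure u → Der Teqn E (u ≣ [ Y ])

  ∅ : Formula → Set
  ∅ _ = ⊥

  ⟅_⟆ : Formula → Formula → Set
  ⟅ φ ⟆ ψ = ψ ≡ φ

  ⟅_,_⟆ : Formula → Formula → Formula → Set
  ⟅ φ₁ , φ₂ ⟆ ψ = ψ ≡ φ₁ ⊎ ψ ≡ φ₂

  TEquiv : (PEq → Set) → (Formula → Set) → (Formula → Set) → Set
  TEquiv Teqn E₁ E₂ = ∀ φ → (Der Teqn E₁ φ → Der Teqn E₂ φ) × (Der Teqn E₂ φ → Der Teqn E₁ φ)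

  -- [ ]_Y is a monomorphism with respect to propagators, in T_excore and
  -- in every theory T_excore + Th(E) extending it
  MonoProp : (PEq → Set) → Type → Set₁
  MonoProp Teqn Y = ∀ (E : Formula → Set) {X} (b₁ b₂ : Term X 𝟘) →
    IsPropagator b₁ → IsPropagator b₂ →
    Der Teqn E ([ Y ] ∘ b₁ ≣ [ Y ] ∘ b₂) → Der Teqn E (b₁ ≣ b₂)

-- A term f : X → Y is determined by two propagators: the term g it agrees
-- with weakly (rule eq₁ compares propagators by weak equations) and the term b
-- with f ∘ [ X ] ≣ b ∘ untag (rule eq₂ adds this behaviour on exceptions, and
-- b is recovered from b ∘ untag since untag ∘ tag ∼ id). For
-- f = a ∘ untag ∘ tag ∘ u these are g = a ∘ u and b = a; for a propagator a
-- they are g = a and b = [ Y ] ∘ tag, by eq₃. Hence f₁ ∼ f₂ amounts to g₁ ≣ g₂,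
-- and f₁ ≣ f₂ to g₁ ≣ g₂ together with b₁ ≣ b₂. Part (3): untag undoes tag up
-- to a weak equation, so tag is a monomorphism on pure terms.
module Submission where

open import Defs
open import Data.Nat using (_⊔_; _≤_; z≤n; s≤s)
open import Data.Nat.Properties using (⊔-lub; ⊔-assoc)
open import Data.Product using (_×_; _,′_; proj₁; proj₂)
open import Data.Sum using (inj₁; inj₂; swap)
open import Relation.Binary.Bundles using (Setoid)
open import Relation.Binary.PropositionalEquality as ≡ using (_≡_; refl; cong; subst)
import Relation.Binary.Reasoning.Setoid as SetoidReasoning

module TermProperties (S : Sig) where
  open Excore S

  ∘-assoc : ∀ {A W X Y Z} (f : Path A Y Z) (g : Path A X Y) (h : Path A W X) →
            (f ∘ g) ∘ h ≡ f ∘ (g ∘ h)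
  ∘-assoc id      g h = refl
  ∘-assoc (a · f) g h = cong (a ·_) (∘-assoc f g h)

  ∘-identityʳ : ∀ {A X Y} (f : Path A X Y) → f ∘ id ≡ f
  ∘-identityʳ id      = refl
  ∘-identityʳ (a · f) = cong (a ·_) (∘-identityʳ f)

  deco-∘ : ∀ {X Y Z} (f : Term Y Z) (g : Term X Y) → deco (f ∘ g) ≡ deco f ⊔ deco g
  deco-∘ id      g = refl
  deco-∘ (a · f) g = ≡.trans (cong (decoA a ⊔_) (deco-∘ f g))
                             (≡.sym (⊔-assoc (decoA a) (deco f) (deco g)))

  IsPropagator-∘ : ∀ {X Y Z} (f : Term Y Z) (g : Term X Y) →
                   IsPropagator f → IsPropagator g → IsPropagator (f ∘ g)
  IsPropagator-∘ f g f-prop g-prop =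
    subst (_≤ 1) (≡.sym (deco-∘ f g)) (⊔-lub f-prop g-prop)

  IsPure⇒IsPropagator : ∀ {X Y} (f : Term X Y) → IsPure f → IsPropagator f
  IsPure⇒IsPropagator f f-pure = subst (_≤ 1) (≡.sym f-pure) z≤n

  tag-propagator : IsPropagator tag
  tag-propagator = s≤s z≤n

  []-propagator : ∀ Y → IsPropagator [ Y ]
  []-propagator Y = z≤n

module Derivations (S : Sig) (Teqn : Excore.PEq S → Set) where
  open Excore S
  open TermProperties S

  Theorem : Formula → Set₁
  Theorem φ = ∀ {E} → Der Teqn E φ

  Der-cut : ∀ {E₁ E₂} → (∀ {ψ} → E₁ ψ → Der Teqn E₂ ψ) →
            ∀ {φ} → Der Teqn E₁ φ → Der Teqn E₂ φ
  Der-cut h (eqn x)        = eqn x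
  Der-cut h (hyp x)        = h x
  Der-cut h (s-refl f)     = s-refl f
  Der-cut h (s-sym d)      = s-sym (Der-cut h d)
  Der-cut h (s-trans d e)  = s-trans (Der-cut h d) (Der-cut h e)
  Der-cut h (s-subs u d)   = s-subs u (Der-cut h d)
  Der-cut h (s-repl w d)   = s-repl w (Der-cut h d)
  Der-cut h (w-refl f)     = w-refl f
  Der-cut h (w-sym d)      = w-sym (Der-cut h d)
  Der-cut h (w-trans d e)  = w-trans (Der-cut h d) (Der-cut h e)
  Der-cut h (w-subs u p d) = w-subs u p (Der-cut h d)
  Der-cut h (w-repl w d)   = w-repl w (Der-cut h d)
  Der-cut h (empty∼ f)     = empty∼ f
  Der-cut h (s⇒w d)        = s⇒w (Der-cut h d)
  Der-cut h ax             = ax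
  Der-cut h (eq₁ p q d)    = eq₁ p q (Der-cut h d)
  Der-cut h (eq₂ d e)      = eq₂ (Der-cut h d) (Der-cut h e)
  Der-cut h (eq₃ d)        = eq₃ (Der-cut h d)
  Der-cut h (initial u p)  = initial u p

  TEquiv-intro : ∀ {E₁ E₂} → (∀ {ψ} → E₁ ψ → Der Teqn E₂ ψ) →
                 (∀ {ψ} → E₂ ψ → Der Teqn E₁ ψ) → TEquiv Teqn E₁ E₂
  TEquiv-intro h₁ h₂ φ = Der-cut h₁ ,′ Der-cut h₂

  TEquiv-trans : ∀ {E₁ E₂ E₃} → TEquiv Teqn E₁ E₂ → TEquiv Teqn E₂ E₃ →
                 TEquiv Teqn E₁ E₃
  TEquiv-trans e₁₂ e₂₃ φ =
    (λ d → proj₁ (e₂₃ φ) (proj₁ (e₁₂ φ) d)) ,′ (λ d → proj₂ (e₁₂ φ) (proj₂ (e₂₃ φ) d))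

  TEquiv-⟅,⟆-comm : ∀ {φ ψ} → TEquiv Teqn ⟅ φ , ψ ⟆ ⟅ ψ , φ ⟆
  TEquiv-⟅,⟆-comm = TEquiv-intro (λ p → hyp (swap p)) (λ p → hyp (swap p))

  derive⟅_⟆ : ∀ {E φ} → Der Teqn E φ → ∀ {ψ} → ⟅ φ ⟆ ψ → Der Teqn E ψ
  derive⟅ d ⟆ refl = d

  derive⟅_,_⟆ : ∀ {E φ₁ φ₂} → Der Teqn E φ₁ → Der Teqn E φ₂ →
                ∀ {ψ} → ⟅ φ₁ , φ₂ ⟆ ψ → Der Teqn E ψ
  derive⟅ d₁ , d₂ ⟆ (inj₁ refl) = d₁
  derive⟅ d₁ , d₂ ⟆ (inj₂ refl) = d₂

  ≣-setoid : (Formula → Set) → Type → Type → Setoid _ _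
  ≣-setoid E X Y = record
    { Carrier       = Term X Y
    ; _≈_           = λ f g → Der Teqn E (f ≣ g)
    ; isEquivalence = record { refl = s-refl _ ; sym = s-sym ; trans = s-trans }
    }

  ∼-setoid : (Formula → Set) → Type → Type → Setoid _ _
  ∼-setoid E X Y = record
    { Carrier       = Term X Y
    ; _≈_           = λ f g → Der Teqn E (f ∼ g)
    ; isEquivalence = record { refl = w-refl _ ; sym = w-sym ; trans = w-trans }
    }

  propagators-from-𝟘-≣ : ∀ {Y} {h₁ h₂ : Term 𝟘 Y} →
                          IsPropagator h₁ → IsPropagator h₂ → Theorem (h₁ ≣ h₂)
  propagators-from-𝟘-≣ {h₁ = h₁} {h₂} h₁-prop h₂-prop =
    eq₁ h₁-prop h₂-prop (w-trans (empty∼ h₁) (w-sym (empty∼ h₂)))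

  untag∘tag-cancel∼ : ∀ {X Y} (a : Term P Y) {u : Term X P} → IsPure u →
                      Theorem (a ∘ untag ∘ tag ∘ u ∼ a ∘ u)
  untag∘tag-cancel∼ a {u} u-pure = w-repl a (w-subs u u-pure ax)

  untag∘tag-on-exceptions : ∀ {X Y} (a : Term P Y) {u : Term X P} → IsPure u →
                   Theorem ((a ∘ untag ∘ tag ∘ u) ∘ [ X ] ≣ a ∘ untag)
  untag∘tag-on-exceptions {X} {Y} a {u} u-pure {E} = begin
    (a ∘ untag ∘ tag ∘ u) ∘ [ X ]  ≡⟨ ∘-assoc a (untag ∘ tag ∘ u) [ X ] ⟩
    a ∘ untag ∘ tag ∘ u ∘ [ X ]    ≈⟨ s-repl a (s-repl untag tag∘u∘[]≣id) ⟩
    a ∘ untag                      ∎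
    where
    open SetoidReasoning (≣-setoid E 𝟘 Y)
    tag∘u∘[]≣id : Der Teqn E (tag ∘ u ∘ [ X ] ≣ id)
    tag∘u∘[]≣id = propagators-from-𝟘-≣
      (IsPropagator-∘ tag (u ∘ [ X ]) tag-propagator
        (IsPropagator-∘ u [ X ] (IsPure⇒IsPropagator u u-pure) ([]-propagator X)))
      z≤n

  []∘tag∘untag≣[] : ∀ {Y} → Theorem (([ Y ] ∘ tag) ∘ untag ≣ [ Y ])
  []∘tag∘untag≣[] {Y} = eq₃ (w-repl ([ Y ] ∘ tag) ax)

  untag-cancelʳ : ∀ {E Y} {b₁ b₂ : Term P Y} → IsPropagator b₁ → IsPropagator b₂ →
                  Der Teqn E (b₁ ∘ untag ≣ b₂ ∘ untag) → Der Teqn E (b₁ ≣ b₂)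
  untag-cancelʳ {E} {Y} {b₁} {b₂} b₁-prop b₂-prop b₁∘untag≣b₂∘untag =
    eq₁ b₁-prop b₂-prop (begin
      b₁                    ≡⟨ ≡.sym (∘-identityʳ b₁) ⟩
      b₁ ∘ id               ≈⟨ untag∘tag-cancel∼ b₁ refl ⟨
      b₁ ∘ untag ∘ tag      ≡⟨ ∘-assoc b₁ untag tag ⟨
      (b₁ ∘ untag) ∘ tag    ≈⟨ s⇒w (s-subs tag b₁∘untag≣b₂∘untag) ⟩
      (b₂ ∘ untag) ∘ tag    ≡⟨ ∘-assoc b₂ untag tag ⟩
      b₂ ∘ untag ∘ tag      ≈⟨ untag∘tag-cancel∼ b₂ refl ⟩
      b₂ ∘ id               ≡⟨ ∘-identityʳ b₂ ⟩
      b₂                    ∎)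
    where open SetoidReasoning (∼-setoid E P Y)

  tag-cancelˡ : ∀ {E X} {v₁ v₂ : Term X P} → IsPure v₁ → IsPure v₂ →
                Der Teqn E (tag ∘ v₁ ≣ tag ∘ v₂) → Der Teqn E (v₁ ≣ v₂)
  tag-cancelˡ {E} {X} {v₁} {v₂} v₁-pure v₂-pure tag∘v₁≣tag∘v₂ =
    eq₁ (IsPure⇒IsPropagator v₁ v₁-pure) (IsPure⇒IsPropagator v₂ v₂-pure) (begin
      v₁                 ≈⟨ untag∘tag-cancel∼ id v₁-pure ⟨
      untag ∘ tag ∘ v₁   ≈⟨ s⇒w (s-repl untag tag∘v₁≣tag∘v₂) ⟩
      untag ∘ tag ∘ v₂   ≈⟨ untag∘tag-cancel∼ id v₂-pure ⟩
      v₂                 ∎)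
    where open SetoidReasoning (∼-setoid E X P)

  record Decomposition {X Y} (f g : Term X Y) (b : Term P Y) : Set₁ where
    field
      g-propagator   : IsPropagator g
      b-propagator   : IsPropagator b
      weakly-equal   : Theorem (f ∼ g)
      on-exceptions  : Theorem (f ∘ [ X ] ≣ b ∘ untag)

  untag∘tag-decomposition : ∀ {X Y} (a : Term P Y) (u : Term X P) →
    IsPropagator a → IsPure u → Decomposition (a ∘ untag ∘ tag ∘ u) (a ∘ u) a
  untag∘tag-decomposition a u a-prop u-pure = record
    { g-propagator  = IsPropagator-∘ a u a-prop (IsPure⇒IsPropagator u u-pure)
    ; b-propagator  = a-prop
    ; weakly-equal  = untag∘tag-cancel∼ a u-pure
    ; on-exceptions = untag∘tag-on-exceptions a u-pure
    }

  propagator-decomposition : ∀ {X Y} (a : Term X Y) →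
    IsPropagator a → Decomposition a a ([ Y ] ∘ tag)
  propagator-decomposition {X} {Y} a a-prop = record
    { g-propagator  = a-prop
    ; b-propagator  = tag-propagator
    ; weakly-equal  = w-refl a
    ; on-exceptions = s-trans
        (propagators-from-𝟘-≣ (IsPropagator-∘ a [ X ] a-prop ([]-propagator X))
                              ([]-propagator Y))
        (s-sym []∘tag∘untag≣[])
    }

  module _ {X Y} {f₁ f₂ g₁ g₂ : Term X Y} {b₁ b₂ : Term P Y}
           (d₁ : Decomposition f₁ g₁ b₁) (d₂ : Decomposition f₂ g₂ b₂) where
    private
      module D₁ = Decomposition d₁
      module D₂ = Decomposition d₂

    weakly-equal⇒≣ : ∀ {E} → Der Teqn E (f₁ ∼ f₂) → Der Teqn E (g₁ ≣ g₂)
    weakly-equal⇒≣ {E} f₁∼f₂ = eq₁ D₁.g-propagator D₂.g-propagator (begin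
      g₁  ≈⟨ D₁.weakly-equal ⟨
      f₁  ≈⟨ f₁∼f₂ ⟩
      f₂  ≈⟨ D₂.weakly-equal ⟩
      g₂  ∎)
      where open SetoidReasoning (∼-setoid E X Y)

    ≣⇒weakly-equal : ∀ {E} → Der Teqn E (g₁ ≣ g₂) → Der Teqn E (f₁ ∼ f₂)
    ≣⇒weakly-equal {E} g₁≣g₂ = begin
      f₁  ≈⟨ D₁.weakly-equal ⟩
      g₁  ≈⟨ s⇒w g₁≣g₂ ⟩
      g₂  ≈⟨ D₂.weakly-equal ⟨
      f₂  ∎
      where open SetoidReasoning (∼-setoid E X Y)

    on-exceptions-≣ : ∀ {E} → Der Teqn E (f₁ ∘ [ X ] ≣ f₂ ∘ [ X ]) →
                      Der Teqn E (b₁ ≣ b₂)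
    on-exceptions-≣ {E} f₁∘[]≣f₂∘[] =
      untag-cancelʳ D₁.b-propagator D₂.b-propagator (begin
        b₁ ∘ untag     ≈⟨ D₁.on-exceptions ⟨
        f₁ ∘ [ X ]     ≈⟨ f₁∘[]≣f₂∘[] ⟩
        f₂ ∘ [ X ]     ≈⟨ D₂.on-exceptions ⟩
        b₂ ∘ untag     ∎)
      where open SetoidReasoning (≣-setoid E 𝟘 Y)

    ≣-on-exceptions : ∀ {E} → Der Teqn E (b₁ ≣ b₂) →
                      Der Teqn E (f₁ ∘ [ X ] ≣ f₂ ∘ [ X ])
    ≣-on-exceptions {E} b₁≣b₂ = begin
      f₁ ∘ [ X ]     ≈⟨ D₁.on-exceptions ⟩
      b₁ ∘ untag     ≈⟨ s-subs untag b₁≣b₂ ⟩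
      b₂ ∘ untag     ≈⟨ D₂.on-exceptions ⟨
      f₂ ∘ [ X ]     ∎
      where open SetoidReasoning (≣-setoid E 𝟘 Y)

    weak-equation⇔strong-equation : TEquiv Teqn ⟅ f₁ ∼ f₂ ⟆ ⟅ g₁ ≣ g₂ ⟆
    weak-equation⇔strong-equation = TEquiv-intro
      derive⟅ ≣⇒weakly-equal (hyp refl) ⟆
      derive⟅ weakly-equal⇒≣ (hyp refl) ⟆

    strong-equation⇔components : TEquiv Teqn ⟅ f₁ ≣ f₂ ⟆ ⟅ b₁ ≣ b₂ , g₁ ≣ g₂ ⟆
    strong-equation⇔components = TEquiv-intro
      derive⟅ eq₂ (≣⇒weakly-equal (hyp (inj₂ refl))) (≣-on-exceptions (hyp (inj₁ refl))) ⟆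
      derive⟅ on-exceptions-≣ (s-subs [ X ] (hyp refl))
            , weakly-equal⇒≣ (s⇒w (hyp refl)) ⟆

  []∘tag∘-injective : ∀ {X Y} → MonoProp Teqn Y → {v₁ v₂ : Term X P} →
    IsPure v₁ → IsPure v₂ →
    TEquiv Teqn ⟅ [ Y ] ∘ tag ∘ v₁ ≣ [ Y ] ∘ tag ∘ v₂ ⟆ ⟅ v₁ ≣ v₂ ⟆
  []∘tag∘-injective {Y = Y} mono {v₁} {v₂} v₁-pure v₂-pure = TEquiv-intro
    derive⟅ s-repl ([ Y ] ∘ tag) (hyp refl) ⟆
    derive⟅ tag-cancelˡ v₁-pure v₂-pure
              (mono _ (tag ∘ v₁) (tag ∘ v₂)
                    (tag∘-propagator v₁ v₁-pure) (tag∘-propagator v₂ v₂-pure) (hyp refl)) ⟆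
    where
    tag∘-propagator : ∀ v → IsPure v → IsPropagator (tag ∘ v)
    tag∘-propagator v v-pure =
      IsPropagator-∘ tag v tag-propagator (IsPure⇒IsPropagator v v-pure)

proposition4p5 : (S : Sig) → let open Excore S in
    (Teqn : PEq → Set) → IsEqnTheory Teqn →
    (∀ {X Y} (a₁ a₂ : Term P Y) (u₁ u₂ : Term X P) →
       IsPropagator a₁ → IsPropagator a₂ → IsPure u₁ → IsPure u₂ →
       TEquiv Teqn ⟅ a₁ ∘ untag ∘ tag ∘ u₁ ∼ a₂ ∘ untag ∘ tag ∘ u₂ ⟆
                   ⟅ a₁ ∘ u₁ ≣ a₂ ∘ u₂ ⟆
       × TEquiv Teqn ⟅ a₁ ∘ untag ∘ tag ∘ u₁ ≣ a₂ ∘ untag ∘ tag ∘ u₂ ⟆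
                     ⟅ a₁ ≣ a₂ , a₁ ∘ u₁ ≣ a₂ ∘ u₂ ⟆)
    × (∀ {X Y} (a₁ : Term P Y) (a₂ : Term X Y) (u₁ : Term X P) →
       IsPropagator a₁ → IsPropagator a₂ → IsPure u₁ →
       TEquiv Teqn ⟅ a₁ ∘ untag ∘ tag ∘ u₁ ∼ a₂ ⟆ ⟅ a₁ ∘ u₁ ≣ a₂ ⟆
       × TEquiv Teqn ⟅ a₁ ∘ untag ∘ tag ∘ u₁ ≣ a₂ ⟆
                     ⟅ a₁ ∘ u₁ ≣ a₂ , a₁ ≣ [ Y ] ∘ tag ⟆)
    × (∀ {X Y} → MonoProp Teqn Y → (v₁ v₂ : Term X P) → IsPure v₁ → IsPure v₂ →
       TEquiv Teqn ⟅ [ Y ] ∘ tag ∘ v₁ ≣ [ Y ] ∘ tag ∘ v₂ ⟆ ⟅ v₁ ≣ v₂ ⟆)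
proposition4p5 S Teqn _ =
    (λ {_} {_} a₁ a₂ u₁ u₂ a₁-prop a₂-prop u₁-pure u₂-pure →
      let d₁ = untag∘tag-decomposition a₁ u₁ a₁-prop u₁-pure
          d₂ = untag∘tag-decomposition a₂ u₂ a₂-prop u₂-pure
      in  weak-equation⇔strong-equation d₁ d₂ ,′ strong-equation⇔components d₁ d₂)
  ,′ (λ {_} {_} a₁ a₂ u₁ a₁-prop a₂-prop u₁-pure →
      let d₁ = untag∘tag-decomposition a₁ u₁ a₁-prop u₁-pure
          d₂ = propagator-decomposition a₂ a₂-prop
      in  weak-equation⇔strong-equation d₁ d₂
          ,′ TEquiv-trans (strong-equation⇔components d₁ d₂) TEquiv-⟅,⟆-comm)
  ,′ (λ {_} {_} mono v₁ v₂ v₁-pure v₂-pure → []∘tag∘-injective mono v₁-pure v₂-pure)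
  where
  open Excore S
  open Derivations S Teqn
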